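{- Let $\Lambda \neq \mathbb{N}$ be a numerical semigroup and $\Delta \in \mathbb{Z}$ with $f(\Lambda) < 2m(\Lambda) + \Delta$. Then $\tau(\Lambda, \Delta) = \{0\} \cup \big((\Lambda \setminus \{0\}) + \Delta\big)$ is also a numerical semigroup.
   Context: A numerical semigroup is a subset $\Lambda \subseteq \mathbb{N}$ containing $0$, closed under addition, with finite complement. Multiplicity $m(\Lambda)=\min(\Lambda\setminus\{0\})$; Frobenius number $f(\Lambda)=\max(\mathbb{N}\setminus\Lambda)$, defined for $\Lambda\ne\mathbb{N}$. For a set $A$ and integer $\Delta$, $A + \Delta = \{a+\Delta : a \in A\}$. -}

module Defs where

open import Data.Nat as ℕ using (ℕ; _≤_)
open import Data.Integer as ℤ using (ℤ; +_)
open import Data.Product using (Σ; _×_; ∃)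
open import Relation.Nullary using (¬_)
open import Relation.Binary.PropositionalEquality using (_≡_)
open import Relation.Unary using (Pred; _∈_; _∉_)
open import Data.Sum using (_⊎_)
open import Level using (0ℓ)

record IsNumericalSemigroup (Λ : Pred ℕ 0ℓ) : Set where
  field
    zero∈ : 0 ∈ Λ
    +-closed : ∀ {a b} → a ∈ Λ → b ∈ Λ → a ℕ.+ b ∈ Λ
    cofinite : ∃ λ N → ∀ n → N ≤ n → n ∈ Λ

IsMultiplicity : Pred ℕ 0ℓ → ℕ → Set
IsMultiplicity Λ m = m ∈ Λ × ¬ (m ≡ 0) × (∀ x → x ∈ Λ → ¬ (x ≡ 0) → m ≤ x)

IsFrobenius : Pred ℕ 0ℓ → ℕ → Set
IsFrobenius Λ f = f ∉ Λ × (∀ n → f ℕ.< n → n ∈ Λ)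

τ : Pred ℕ 0ℓ → ℤ → Pred ℤ 0ℓ
τ Λ Δ z = z ≡ + 0 ⊎ Σ ℕ (λ l → l ∈ Λ × ¬ (l ≡ 0) × z ≡ (+ l) ℤ.+ Δ)

module Submission where

open import Defs
open import Data.Nat using (ℕ)
open import Data.Integer using (ℤ; +_; _+_; _*_; _<_; _≤_)
open import Data.Product using (_×_)
open import Relation.Unary using (Pred)
open import Level using (0ℓ)

open import Data.Integer using (-[1+_]; -_; _-_; ∣_∣; +≤+; +<+; -≤+)
import Data.Integer.Properties as ℤ
open import Data.Integer.Tactic.RingSolver using (solve-∀)
import Data.Nat as ℕ
import Data.Nat.Properties as ℕ
open import Data.Product using (∃; _,_; proj₂)
open import Data.Sum using (inj₁; inj₂)
open import Relation.Binary.PropositionalEquality using (_≡_; _≢_; refl; sym; trans; cong₂; subst)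
open import Relation.Unary using (_∈_)

-- Every element of τ Λ Δ other than 0 is at least m + Δ, and m ≤ f + 1 together
-- with f < 2m + Δ makes this non-negative.  A sum of two such elements is
-- (l₁ + l₂ + Δ) + Δ with l₁ + l₂ + Δ ≥ 2m + Δ > f, so l₁ + l₂ + Δ lies in Λ;
-- and every n ≥ f + Δ + 1 is (n - Δ) + Δ with n - Δ > f in Λ.

private
  2i+j-i≡i+j : ∀ i j → + 2 * i + j - i ≡ i + j
  2i+j-i≡i+j = solve-∀

  2i≡i+i : ∀ i → + 2 * i ≡ i + i
  2i≡i+i = solve-∀

  i+j+[k+j]≡[i+k+j]+j : ∀ i j k → (i + j) + (k + j) ≡ (i + k + j) + j
  i+j+[k+j]≡[i+k+j]+j = solve-∀

  i-j+j≡i : ∀ i j → i - j + j ≡ i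
  i-j+j≡i = solve-∀

  i+j-j≡i : ∀ i j → i + j - j ≡ i
  i+j-j≡i = solve-∀

i≤+∣i∣ : ∀ i → i ≤ + ∣ i ∣
i≤+∣i∣ (+ n)    = ℤ.≤-refl
i≤+∣i∣ -[1+ n ] = -≤+

multiplicity+Δ-nonneg : ∀ {m f Δ} → m ℕ.≤ ℕ.suc f → + f < + 2 * + m + Δ → + 0 ≤ + m + Δ
multiplicity+Δ-nonneg {m} {f} {Δ} m≤1+f f<2m+Δ =
  subst (+ 0 ≤_) (2i+j-i≡i+j (+ m) Δ)
    (ℤ.i≤j⇒0≤j-i (ℤ.≤-trans (+≤+ m≤1+f) (ℤ.i<j⇒suc[i]≤j f<2m+Δ)))

module _ {Λ : Pred ℕ 0ℓ} {f : ℕ} (frobenius : IsFrobenius Λ f) where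
  frobenius<⇒nonzero-element : ∀ z → + f < z → ∃ λ l → l ∈ Λ × l ≢ 0 × + l ≡ z
  frobenius<⇒nonzero-element (+ k) (+<+ f<k) =
    k , proj₂ frobenius k f<k , (λ { refl → ℕ.<⇒≱ f<k ℕ.z≤n }) , refl

  multiplicity≤1+frobenius : ∀ {m} → IsMultiplicity Λ m → m ℕ.≤ ℕ.suc f
  multiplicity≤1+frobenius (_ , _ , minimal) =
    minimal (ℕ.suc f) (proj₂ frobenius (ℕ.suc f) ℕ.≤-refl) (λ ())

  frobenius<⇒shift∈τ : ∀ Δ z → + f < z → τ Λ Δ (z + Δ)
  frobenius<⇒shift∈τ Δ z f<z with frobenius<⇒nonzero-element z f<z
  ... | l , l∈Λ , l≢0 , refl = inj₂ (l , l∈Λ , l≢0 , refl)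

  τ-cofinite : ∀ Δ → ∃ λ N → ∀ n → N ℕ.≤ n → τ Λ Δ (+ n)
  τ-cofinite Δ = ℕ.suc ∣ + f + Δ ∣ , λ n N≤n →
    subst (τ Λ Δ) (i-j+j≡i (+ n) Δ) (frobenius<⇒shift∈τ Δ (+ n - Δ) (f<n-Δ n N≤n))
    where
    f<n-Δ : ∀ n → ℕ.suc ∣ + f + Δ ∣ ℕ.≤ n → + f < + n - Δ
    f<n-Δ n N≤n = subst (_< + n - Δ) (i+j-j≡i (+ f) Δ)
      (ℤ.+-monoˡ-< (- Δ) (ℤ.≤-<-trans (i≤+∣i∣ (+ f + Δ)) (+<+ N≤n)))

module _ {Λ : Pred ℕ 0ℓ} {m : ℕ} (multiplicity : IsMultiplicity Λ m) where
  τ-nonneg : ∀ {Δ z} → + 0 ≤ + m + Δ → τ Λ Δ z → + 0 ≤ z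
  τ-nonneg _           (inj₁ refl)                      = +≤+ ℕ.z≤n
  τ-nonneg {Δ} 0≤m+Δ (inj₂ (l , l∈Λ , l≢0 , refl)) =
    ℤ.≤-trans 0≤m+Δ (ℤ.+-monoˡ-≤ Δ (+≤+ (proj₂ (proj₂ multiplicity) l l∈Λ l≢0)))

  τ-+-closed : ∀ {f Δ a b} → IsFrobenius Λ f → + f < + 2 * + m + Δ →
               τ Λ Δ (+ a) → τ Λ Δ (+ b) → τ Λ Δ (+ (a ℕ.+ b))
  τ-+-closed _ _ (inj₁ refl) b∈τ = b∈τ
  τ-+-closed {Δ = Δ} {a = a} _ _ a∈τ (inj₁ refl) =
    subst (λ n → τ Λ Δ (+ n)) (sym (ℕ.+-identityʳ a)) a∈τ
  τ-+-closed {f} {Δ} {a} {b} frobenius f<2m+Δ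
    (inj₂ (l₁ , l₁∈Λ , l₁≢0 , a≡l₁+Δ)) (inj₂ (l₂ , l₂∈Λ , l₂≢0 , b≡l₂+Δ)) =
    subst (τ Λ Δ) (sym a+b≡[l₁+l₂+Δ]+Δ)
      (frobenius<⇒shift∈τ frobenius Δ (+ l₁ + + l₂ + Δ) f<l₁+l₂+Δ)
    where
    minimal : ∀ l → l ∈ Λ → l ≢ 0 → m ℕ.≤ l
    minimal = proj₂ (proj₂ multiplicity)

    f<l₁+l₂+Δ : + f < + l₁ + + l₂ + Δ
    f<l₁+l₂+Δ = ℤ.<-≤-trans f<2m+Δ (ℤ.+-monoˡ-≤ Δ
      (subst (_≤ + l₁ + + l₂) (sym (2i≡i+i (+ m)))
        (ℤ.+-mono-≤ (+≤+ (minimal l₁ l₁∈Λ l₁≢0)) (+≤+ (minimal l₂ l₂∈Λ l₂≢0)))))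

    a+b≡[l₁+l₂+Δ]+Δ : + a + + b ≡ (+ l₁ + + l₂ + Δ) + Δ
    a+b≡[l₁+l₂+Δ]+Δ = trans (cong₂ _+_ a≡l₁+Δ b≡l₂+Δ) (i+j+[k+j]≡[i+k+j]+j (+ l₁) Δ (+ l₂))

lemma5 : (Λ : Pred ℕ 0ℓ) (Δ : ℤ) (m f : ℕ) →
    IsNumericalSemigroup Λ → IsMultiplicity Λ m → IsFrobenius Λ f →
    + f < (+ 2) * (+ m) + Δ →
    (∀ z → τ Λ Δ z → + 0 ≤ z) × IsNumericalSemigroup (λ n → τ Λ Δ (+ n))
lemma5 Λ Δ m f _ multiplicity frobenius f<2m+Δ =
  (λ _ → τ-nonneg multiplicity {Δ} 0≤m+Δ) , record
    { zero∈    = inj₁ refl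
    ; +-closed = τ-+-closed multiplicity frobenius f<2m+Δ
    ; cofinite = τ-cofinite frobenius Δ
    }
  where
  0≤m+Δ : + 0 ≤ + m + Δ
  0≤m+Δ = multiplicity+Δ-nonneg (multiplicity≤1+frobenius frobenius multiplicity) f<2m+Δ
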